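{- Let $X$ be an msp-expression whose vertices are items with positive integer sizes, and let $c$ be a positive integer capacity. For $0\le s\le c$: (1) For a single vertex $a_j$, $F(a_j,s)=1$ if and only if $s=0$ or $s=s_j$. (2) $F(X_1\cup X_2,s)=1$ if and only if there are $0\le s'\le s$ and $0\le s''\le s$ with $s'+s''=s$, $F(X_1,s')=1$ and $F(X_2,s'')=1$. (3) $F(X_1\times X_2,s)=1$ if and only if either $0\le s\le s(X_2)$ and $F(X_2,s)=1$, or there is some $1\le s'\le s(X_1)$ with $s=s'+s(X_2)$ and $F(X_1,s')=1$. In all other cases the respective value is $0$.
   Context: For vertex-disjoint digraphs $G_1=(V_1,E_1)$, $G_2=(V_2,E_2)$, let $O_1$ be the set of sinks (outdegree $0$) of $G_1$ and $I_2$ the set of sources (indegree $0$) of $G_2$. The parallel composition $G_1\cup G_2$ has vertex set $V_1\cup V_2$ and arc set $E_1\cup E_2$; the series composition $G_1\times G_2$ has vertex set $V_1\cup V_2$ and arc set $E_1\cup E_2\cup(O_1\times I_2)$. An msp-expression is a term built from single vertices by these two operations; for an msp-expression $X'$, $g(X')$ is the (minimal series-parallel) digraph it defines and $s(X')$ is the sum of the sizes of all vertices of $g(X')$. For an msp-expression $X'$ and integer $s$, $F(X',s)=1$ if there exists a subset $A'$ of the vertices of $g(X')$ with $\sum_{a_j\in A'}s_j=s$, $\sum_{a_j\in A'}s_j\le c$, and such that for every vertex $y$ of $g(X')$, if some predecessor of $y$ in $g(X')$ lies in $A'$ then $y\in A'$; otherwise $F(X',s)=0$. -}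

module Defs where

open import Data.Nat using (ℕ; _+_; _≤_; _<_)
open import Data.Bool using (Bool; true; false; T; if_then_else_)
open import Data.Unit using (⊤; tt)
open import Data.Empty using (⊥)
open import Data.Sum using (_⊎_; inj₁; inj₂)
open import Data.Product using (Σ; _×_; ∃; ∃-syntax)
open import Relation.Nullary using (¬_)
open import Relation.Binary.PropositionalEquality using (_≡_)

-- Vertices of g(X) are the leaves of X (distinct positions are distinct
-- vertices, so the composed digraphs are automatically vertex-disjoint).
data MSP : Set where
  vertex : (size : ℕ) → MSP
  _∪ₘ_   : MSP → MSP → MSP
  _×ₘ_   : MSP → MSP → MSP

Vtx : MSP → Set
Vtx (vertex _) = ⊤
Vtx (X ∪ₘ Y)   = Vtx X ⊎ Vtx Y
Vtx (X ×ₘ Y)   = Vtx X ⊎ Vtx Y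

sizeOf : (X : MSP) → Vtx X → ℕ
sizeOf (vertex n) _      = n
sizeOf (X ∪ₘ Y) (inj₁ u) = sizeOf X u
sizeOf (X ∪ₘ Y) (inj₂ v) = sizeOf Y v
sizeOf (X ×ₘ Y) (inj₁ u) = sizeOf X u
sizeOf (X ×ₘ Y) (inj₂ v) = sizeOf Y v

Arc    : (X : MSP) → Vtx X → Vtx X → Set
IsSink : (X : MSP) → Vtx X → Set
IsSource : (X : MSP) → Vtx X → Set

Arc (vertex _) _ _               = ⊥
Arc (X ∪ₘ Y) (inj₁ u) (inj₁ v)   = Arc X u v
Arc (X ∪ₘ Y) (inj₁ u) (inj₂ v)   = ⊥
Arc (X ∪ₘ Y) (inj₂ u) (inj₁ v)   = ⊥
Arc (X ∪ₘ Y) (inj₂ u) (inj₂ v)   = Arc Y u v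
Arc (X ×ₘ Y) (inj₁ u) (inj₁ v)   = Arc X u v
Arc (X ×ₘ Y) (inj₁ u) (inj₂ v)   = IsSink X u × IsSource Y v
Arc (X ×ₘ Y) (inj₂ u) (inj₁ v)   = ⊥
Arc (X ×ₘ Y) (inj₂ u) (inj₂ v)   = Arc Y u v

IsSink X u = ∀ v → ¬ Arc X u v
IsSource X v = ∀ u → ¬ Arc X u v

totalSize : MSP → ℕ
totalSize (vertex n) = n
totalSize (X ∪ₘ Y)   = totalSize X + totalSize Y
totalSize (X ×ₘ Y)   = totalSize X + totalSize Y

weight : (X : MSP) → (Vtx X → Bool) → ℕ
weight (vertex n) A = if A tt then n else 0
weight (X ∪ₘ Y) A   = weight X (λ u → A (inj₁ u)) + weight Y (λ v → A (inj₂ v))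
weight (X ×ₘ Y) A   = weight X (λ u → A (inj₁ u)) + weight Y (λ v → A (inj₂ v))

AllPositive : MSP → Set
AllPositive X = ∀ (v : Vtx X) → 0 < sizeOf X v

Closed : (X : MSP) → (Vtx X → Bool) → Set
Closed X A = ∀ (x y : Vtx X) → Arc X x y → T (A x) → T (A y)

-- "F(X, s) = 1" (with capacity c): there is a closed subset A of the vertices
-- of g(X) of total size s with total size ≤ c.
F : (c : ℕ) → MSP → ℕ → Set
F c X s = Σ (Vtx X → Bool) λ A → weight X A ≡ s × weight X A ≤ c × Closed X A

module Submission where

-- Closedness decomposes
-- along the two compositions:
--   * in X ∪ Y a set is closed iff both restrictions are closed;
--   * in X × Y a set is closed iff both restrictions are closed and, whenever
--     it contains a sink of X, it contains every source of Y.
-- The heart of the series case is a dichotomy: a closed set of X × Y either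
-- misses X completely or contains all of Y.  This rests on two facts about
-- msp-digraphs, proved by one mutual induction: a nonempty closed set contains
-- a sink, and a closed set containing every source is everything.

open import Defs
open import Data.Nat using (ℕ; zero; suc; _+_; _≤_; _<_; z≤n; s≤s)
open import Data.Nat.Properties using (≤-trans; ≤-refl; m≤m+n; m≤n+m; +-mono-≤)
open import Data.Bool using (Bool; true; false; T)
open import Data.Unit using (tt)
open import Data.Sum using (_⊎_; inj₁; inj₂; [_,_])
open import Data.Product using (Σ; _×_; ∃-syntax; _,_)
open import Function using (_∘_; const)
open import Function.Bundles using (_⇔_; mk⇔; Equivalence)
open import Relation.Binary.PropositionalEquality
  using (_≡_; refl; sym; trans; cong; cong₂; subst)
open Equivalence using (to; from)

Member : (X : MSP) → (Vtx X → Bool) → Set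
Member X A = Σ (Vtx X) (T ∘ A)

weight-empty : ∀ X → weight X (const false) ≡ 0
weight-empty (vertex n) = refl
weight-empty (X ∪ₘ Y)   = cong₂ _+_ (weight-empty X) (weight-empty Y)
weight-empty (X ×ₘ Y)   = cong₂ _+_ (weight-empty X) (weight-empty Y)

weight-full : ∀ X (A : Vtx X → Bool) → (∀ v → T (A v)) → weight X A ≡ totalSize X
weight-full (vertex n) A all with A tt | all tt
... | true | _ = refl
weight-full (X ∪ₘ Y) A all =
  cong₂ _+_ (weight-full X (A ∘ inj₁) (all ∘ inj₁)) (weight-full Y (A ∘ inj₂) (all ∘ inj₂))
weight-full (X ×ₘ Y) A all =
  cong₂ _+_ (weight-full X (A ∘ inj₁) (all ∘ inj₁)) (weight-full Y (A ∘ inj₂) (all ∘ inj₂))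

weight-≤-total : ∀ X (A : Vtx X → Bool) → weight X A ≤ totalSize X
weight-≤-total (vertex n) A with A tt
... | true  = ≤-refl
... | false = z≤n
weight-≤-total (X ∪ₘ Y) A = +-mono-≤ (weight-≤-total X (A ∘ inj₁)) (weight-≤-total Y (A ∘ inj₂))
weight-≤-total (X ×ₘ Y) A = +-mono-≤ (weight-≤-total X (A ∘ inj₁)) (weight-≤-total Y (A ∘ inj₂))

member : ∀ X (A : Vtx X → Bool) → 0 < weight X A → Member X A
member-⊎ : ∀ X Y (A : Vtx X ⊎ Vtx Y → Bool) →
  0 < weight X (A ∘ inj₁) + weight Y (A ∘ inj₂) → Σ (Vtx X ⊎ Vtx Y) (T ∘ A)

member (vertex n) A pos with A tt in a
... | true = tt , subst T (sym a) tt
member (X ∪ₘ Y) A pos = member-⊎ X Y A pos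
member (X ×ₘ Y) A pos = member-⊎ X Y A pos

member-⊎ X Y A pos with weight X (A ∘ inj₁) in w
... | zero  = let (v , v∈A) = member Y (A ∘ inj₂) pos in inj₂ v , v∈A
... | suc _ = let (u , u∈A) = member X (A ∘ inj₁) (subst (0 <_) (sym w) (s≤s z≤n)) in inj₁ u , u∈A

closed-∪ : ∀ X Y (A : Vtx X ⊎ Vtx Y → Bool) →
  Closed (X ∪ₘ Y) A ⇔ (Closed X (A ∘ inj₁) × Closed Y (A ∘ inj₂))
closed-∪ X Y A = mk⇔ (λ cl → (λ x y → cl (inj₁ x) (inj₁ y)) , (λ x y → cl (inj₂ x) (inj₂ y))) glue
  where
  glue : Closed X (A ∘ inj₁) × Closed Y (A ∘ inj₂) → Closed (X ∪ₘ Y) A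
  glue (cl₁ , cl₂) (inj₁ x) (inj₁ y) = cl₁ x y
  glue (cl₁ , cl₂) (inj₁ x) (inj₂ y) ()
  glue (cl₁ , cl₂) (inj₂ x) (inj₁ y) ()
  glue (cl₁ , cl₂) (inj₂ x) (inj₂ y) = cl₂ x y

-- The arcs added by series composition: a set containing a sink of X must
-- contain every source of Y.
SinksToSources : ∀ X Y → (Vtx X ⊎ Vtx Y → Bool) → Set
SinksToSources X Y A =
  ∀ u v → IsSink X u → IsSource Y v → T (A (inj₁ u)) → T (A (inj₂ v))

closed-× : ∀ X Y (A : Vtx X ⊎ Vtx Y → Bool) →
  Closed (X ×ₘ Y) A ⇔ (Closed X (A ∘ inj₁) × Closed Y (A ∘ inj₂) × SinksToSources X Y A)
closed-× X Y A = mk⇔ split glue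
  where
  split : Closed (X ×ₘ Y) A → Closed X (A ∘ inj₁) × Closed Y (A ∘ inj₂) × SinksToSources X Y A
  split cl = (λ x y → cl (inj₁ x) (inj₁ y)) , (λ x y → cl (inj₂ x) (inj₂ y)) ,
             (λ u v sink src → cl (inj₁ u) (inj₂ v) (sink , src))
  glue : Closed X (A ∘ inj₁) × Closed Y (A ∘ inj₂) × SinksToSources X Y A → Closed (X ×ₘ Y) A
  glue (cl₁ , cl₂ , link) (inj₁ x) (inj₁ y) = cl₁ x y
  glue (cl₁ , cl₂ , link) (inj₁ x) (inj₂ y) (sink , src) = link x y sink src
  glue (cl₁ , cl₂ , link) (inj₂ x) (inj₁ y) ()
  glue (cl₁ , cl₂ , link) (inj₂ x) (inj₂ y) = cl₂ x y

source-∪₁ : ∀ {X Y v} → IsSource X v → IsSource (X ∪ₘ Y) (inj₁ v)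
source-∪₁ src (inj₁ u) = src u
source-∪₁ src (inj₂ u) ()

source-∪₂ : ∀ {X Y v} → IsSource Y v → IsSource (X ∪ₘ Y) (inj₂ v)
source-∪₂ src (inj₁ u) ()
source-∪₂ src (inj₂ u) = src u

source-×₁ : ∀ {X Y v} → IsSource X v → IsSource (X ×ₘ Y) (inj₁ v)
source-×₁ src (inj₁ u) = src u
source-×₁ src (inj₂ u) ()

sink-∪₁ : ∀ {X Y u} → IsSink X u → IsSink (X ∪ₘ Y) (inj₁ u)
sink-∪₁ sink (inj₁ v) = sink v
sink-∪₁ sink (inj₂ v) ()

sink-∪₂ : ∀ {X Y u} → IsSink Y u → IsSink (X ∪ₘ Y) (inj₂ u)
sink-∪₂ sink (inj₁ v) ()
sink-∪₂ sink (inj₂ v) = sink v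

sink-×₂ : ∀ {X Y u} → IsSink Y u → IsSink (X ×ₘ Y) (inj₂ u)
sink-×₂ sink (inj₁ v) ()
sink-×₂ sink (inj₂ v) = sink v

-- Every msp-digraph has a source (its leftmost vertex).
source : ∀ X → Σ (Vtx X) (IsSource X)
source (vertex n) = tt , λ _ ()
source (X ∪ₘ Y) = let (v , src) = source X in inj₁ v , source-∪₁ src
source (X ×ₘ Y) = let (v , src) = source X in inj₁ v , source-×₁ src

closed-sink : ∀ X (A : Vtx X → Bool) → Closed X A → Member X A →
  Σ (Vtx X) λ w → IsSink X w × T (A w)
closed-full : ∀ X (A : Vtx X → Bool) → Closed X A →
  (∀ v → IsSource X v → T (A v)) → ∀ v → T (A v)
series-absorbs : ∀ X Y (A : Vtx X ⊎ Vtx Y → Bool) → Closed (X ×ₘ Y) A →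
  Member X (A ∘ inj₁) → ∀ v → T (A (inj₂ v))

closed-sink (vertex n) A cl (tt , t) = tt , (λ _ ()) , t
closed-sink (X ∪ₘ Y) A cl (inj₁ u , u∈A) =
  let (cl₁ , _) = to (closed-∪ X Y A) cl
      (w , sink , w∈A) = closed-sink X (A ∘ inj₁) cl₁ (u , u∈A)
  in inj₁ w , sink-∪₁ sink , w∈A
closed-sink (X ∪ₘ Y) A cl (inj₂ u , u∈A) =
  let (_ , cl₂) = to (closed-∪ X Y A) cl
      (w , sink , w∈A) = closed-sink Y (A ∘ inj₂) cl₂ (u , u∈A)
  in inj₂ w , sink-∪₂ sink , w∈A
-- In X × Y the sinks of Y are sinks, and a nonempty closed set meets Y.
closed-sink (X ×ₘ Y) A cl (w , w∈A) =
  let (_ , cl₂ , _) = to (closed-× X Y A) cl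
      (w′ , sink , w′∈A) = closed-sink Y (A ∘ inj₂) cl₂ (meets-Y w w∈A)
  in inj₂ w′ , sink-×₂ sink , w′∈A
  where
  meets-Y : ∀ w → T (A w) → Member Y (A ∘ inj₂)
  meets-Y (inj₁ u) u∈A = let (v , _) = source Y in v , series-absorbs X Y A cl (u , u∈A) v
  meets-Y (inj₂ v) v∈A = v , v∈A

closed-full (vertex n) A cl sources tt = sources tt λ _ ()
closed-full (X ∪ₘ Y) A cl sources (inj₁ v) =
  let (cl₁ , _) = to (closed-∪ X Y A) cl
  in closed-full X (A ∘ inj₁) cl₁ (λ v src → sources (inj₁ v) (source-∪₁ src)) v
closed-full (X ∪ₘ Y) A cl sources (inj₂ v) =
  let (_ , cl₂) = to (closed-∪ X Y A) cl
  in closed-full Y (A ∘ inj₂) cl₂ (λ v src → sources (inj₂ v) (source-∪₂ src)) v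
-- In X × Y the sources of X are sources, so A contains all of X; meeting X,
-- it then contains all of Y by series-absorbs.
closed-full (X ×ₘ Y) A cl sources = λ where
    (inj₁ u) → left-full u
    (inj₂ v) → let (u , _) = source X in series-absorbs X Y A cl (u , left-full u) v
  where
  left-full : ∀ u → T (A (inj₁ u))
  left-full = let (cl₁ , _) = to (closed-× X Y A) cl
              in closed-full X (A ∘ inj₁) cl₁ (λ u src → sources (inj₁ u) (source-×₁ src))

-- A closed set meeting X contains a sink of X, hence every source of Y, hence all of Y.
series-absorbs X Y A cl meets =
  let (cl₁ , cl₂ , link) = to (closed-× X Y A) cl
      (w , sink , w∈A) = closed-sink X (A ∘ inj₁) cl₁ meets
  in closed-full Y (A ∘ inj₂) cl₂ (λ v src → link w v sink src w∈A)

witness : ∀ {c s} X (A : Vtx X → Bool) → s ≤ c → weight X A ≡ s → Closed X A → F c X s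
witness X A s≤c refl cl = A , refl , s≤c , cl

-- (1) A single vertex has exactly the closed sets ∅ and {a}.
F-vertex : ∀ {c s} n → s ≤ c → F c (vertex n) s ⇔ (s ≡ 0 ⊎ s ≡ n)
F-vertex {c} {s} n s≤c = mk⇔ weights subsets
  where
  weights : F c (vertex n) s → s ≡ 0 ⊎ s ≡ n
  weights (A , w , _) with A tt
  ... | true  = inj₂ (sym w)
  ... | false = inj₁ (sym w)
  subsets : s ≡ 0 ⊎ s ≡ n → F c (vertex n) s
  subsets (inj₁ s≡0) = witness (vertex n) (const false) s≤c (sym s≡0) λ _ _ ()
  subsets (inj₂ s≡n) = witness (vertex n) (const true) s≤c (sym s≡n) λ _ _ ()

-- (2) Closed sets of X ∪ Y are unions of closed sets of X and of Y.
F-∪ : ∀ {c s} X Y → s ≤ c → F c (X ∪ₘ Y) s ⇔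
  (∃[ s′ ] ∃[ s″ ] (s′ ≤ s × s″ ≤ s × s′ + s″ ≡ s × F c X s′ × F c Y s″))
F-∪ {c} {s} X Y s≤c = mk⇔ split glue
  where
  split : F c (X ∪ₘ Y) s →
    ∃[ s′ ] ∃[ s″ ] (s′ ≤ s × s″ ≤ s × s′ + s″ ≡ s × F c X s′ × F c Y s″)
  split (A , w , _ , cl) =
    let (cl₁ , cl₂) = to (closed-∪ X Y A) cl
        w₁≤s = subst (weight X (A ∘ inj₁) ≤_) w (m≤m+n _ _)
        w₂≤s = subst (weight Y (A ∘ inj₂) ≤_) w (m≤n+m _ _)
    in weight X (A ∘ inj₁) , weight Y (A ∘ inj₂) , w₁≤s , w₂≤s , w ,
       witness X (A ∘ inj₁) (≤-trans w₁≤s s≤c) refl cl₁ ,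
       witness Y (A ∘ inj₂) (≤-trans w₂≤s s≤c) refl cl₂
  glue : ∃[ s′ ] ∃[ s″ ] (s′ ≤ s × s″ ≤ s × s′ + s″ ≡ s × F c X s′ × F c Y s″) →
    F c (X ∪ₘ Y) s
  glue (_ , _ , _ , _ , sum , (A₁ , w₁ , _ , cl₁) , (A₂ , w₂ , _ , cl₂)) =
    witness (X ∪ₘ Y) [ A₁ , A₂ ] s≤c (trans (cong₂ _+_ w₁ w₂) sum) (from (closed-∪ X Y _) (cl₁ , cl₂))

-- (3) A closed set of X × Y either misses X, and is then a closed set of Y, or
-- meets X, and is then a nonempty closed set of X together with all of Y.
F-× : ∀ {c s} X Y → s ≤ c → F c (X ×ₘ Y) s ⇔
  ((s ≤ totalSize Y × F c Y s)
   ⊎ (∃[ s′ ] (1 ≤ s′ × s′ ≤ totalSize X × s ≡ s′ + totalSize Y × F c X s′)))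
F-× {c} {s} X Y s≤c = mk⇔ split glue
  where
  split : F c (X ×ₘ Y) s →
    (s ≤ totalSize Y × F c Y s)
    ⊎ (∃[ s′ ] (1 ≤ s′ × s′ ≤ totalSize X × s ≡ s′ + totalSize Y × F c X s′))
  split (A , w , _ , cl) with to (closed-× X Y A) cl | weight X (A ∘ inj₁) in w₁
  ... | _ , cl₂ , _ | zero =
    inj₁ (subst (_≤ totalSize Y) w (weight-≤-total Y (A ∘ inj₂)) , witness Y (A ∘ inj₂) s≤c w cl₂)
  ... | cl₁ , _ , _ | suc k =
    let meets-X = member X (A ∘ inj₁) (subst (0 <_) (sym w₁) (s≤s z≤n))
        Y-full  = weight-full Y (A ∘ inj₂) (series-absorbs X Y A cl meets-X)
        s≡      = trans (sym w) (cong (suc k +_) Y-full)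
        k<s     = subst (suc k ≤_) w (m≤m+n (suc k) _)
    in inj₂ (suc k , s≤s z≤n , subst (_≤ totalSize X) w₁ (weight-≤-total X (A ∘ inj₁)) , s≡ ,
             witness X (A ∘ inj₁) (≤-trans k<s s≤c) w₁ cl₁)
  glue : (s ≤ totalSize Y × F c Y s)
    ⊎ (∃[ s′ ] (1 ≤ s′ × s′ ≤ totalSize X × s ≡ s′ + totalSize Y × F c X s′)) →
    F c (X ×ₘ Y) s
  glue (inj₁ (_ , (B , w , _ , cl))) =
    witness (X ×ₘ Y) [ const false , B ] s≤c (trans (cong (_+ weight Y B) (weight-empty X)) w)
      (from (closed-× X Y _) ((λ _ _ _ ()) , cl , λ _ _ _ _ ()))
  glue (inj₂ (_ , _ , _ , s≡ , (B , w , _ , cl))) =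
    witness (X ×ₘ Y) [ B , const true ] s≤c
      (trans (cong₂ _+_ w (weight-full Y (const true) (λ _ → tt))) (sym s≡))
      (from (closed-× X Y _) (cl , (λ _ _ _ _ → tt) , λ _ _ _ _ _ → tt))

lemma16 : (c : ℕ) → 0 < c → (s : ℕ) → s ≤ c →
    ((n : ℕ) → 0 < n →
       F c (vertex n) s ⇔ (s ≡ 0 ⊎ s ≡ n))
    × ((X₁ X₂ : MSP) → AllPositive X₁ → AllPositive X₂ →
       F c (X₁ ∪ₘ X₂) s ⇔
         (∃[ s′ ] ∃[ s″ ] (s′ ≤ s × s″ ≤ s × s′ + s″ ≡ s × F c X₁ s′ × F c X₂ s″)))
    × ((X₁ X₂ : MSP) → AllPositive X₁ → AllPositive X₂ →
       F c (X₁ ×ₘ X₂) s ⇔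
         ((s ≤ totalSize X₂ × F c X₂ s)
          ⊎ (∃[ s′ ] (1 ≤ s′ × s′ ≤ totalSize X₁ × s ≡ s′ + totalSize X₂ × F c X₁ s′))))
lemma16 c _ s s≤c =
    (λ n _ → F-vertex n s≤c)
  , (λ X₁ X₂ _ _ → F-∪ X₁ X₂ s≤c)
  , (λ X₁ X₂ _ _ → F-× X₁ X₂ s≤c)
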